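{- Let $S_1,\dots,S_k,T\subseteq\mathbb{Z}$, let $f:S_1\times\cdots\times S_k\to T$ be order-preserving, and let $\tilde f:\mathcal{W}_{S_1}\times\cdots\times\mathcal{W}_{S_k}\to\mathcal{W}_T$ be its extension to games. Let $\Box$ be one of $\lesssim,\gtrsim,\lesssim_+,\lesssim_-,\gtrsim_+,\gtrsim_-,\approx,\approx_+,\approx_-$. If $(G_1,\dots,G_k),(H_1,\dots,H_k)\in\mathcal{W}_{S_1}\times\cdots\times\mathcal{W}_{S_k}$ satisfy $G_i\,\Box\,H_i$ (as $\mathbb{Z}$-valued games) for every $i$, then $\tilde f(G_1,\dots,G_k)\,\Box\,\tilde f(H_1,\dots,H_k)$.
   Context: For $S\subseteq\mathbb{Z}$: an even-tempered $S$-valued game is an element of $S$ (a "number", with no options) or $\langle L\mid R\rangle$ with $L,R$ finite nonempty sets of odd-tempered $S$-valued games; an odd-tempered one is $\langle L\mid R\rangle$ with $L,R$ finite nonempty sets of even-tempered $S$-valued games; $\mathcal{W}_S$ is the set of all of them. Outcomes: $L(n)=R(n)=n$ for numbers; otherwise $L(G)=\max_{G^L}R(G^L)$, $R(G)=\min_{G^R}L(G^R)$. Sum: integer sum if both numbers, otherwise $G+H=\langle G^L+H, G+H^L\mid G^R+H, G+H^R\rangle$. $f$ order-preserving means $a_i\le b_i$ for all $i$ implies $f(a)\le f(b)$. Extension: $\tilde f(G_1,\dots,G_k)=f(G_1,\dots,G_k)$ if all $G_i$ are numbers, and otherwise $\tilde f(G_1,\dots,G_k)=\langle \tilde f(G_1,\dots,G_i^L,\dots,G_k)\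 (1\le i\le k)\mid \tilde f(G_1,\dots,G_i^R,\dots,G_k)\ (1\le i\le k)\rangle$, ranging over all options of all components. $G\lesssim H$ iff $L(G+X)\le L(H+X)$ and $R(G+X)\le R(H+X)$ for all $X\in\mathcal{W}_\mathbb{Z}$. $\mathrm{lf}(G)=L(G)$ if $G$ odd-tempered, $R(G)$ if even; $\mathrm{rf}(G)=R(G)$ if odd-tempered, $L(G)$ if even. For games of the same parity: $G\lesssim_+H$ iff $\mathrm{lf}(G+X)\le\mathrm{lf}(H+X)$ for all $X\in\mathcal{W}_\mathbb{Z}$; $G\lesssim_-H$ iff $\mathrm{rf}(G+X)\le\mathrm{rf}(H+X)$ for all $X$. $\gtrsim,\gtrsim_\pm$ are the reverse relations, and $\approx,\approx_\pm$ are the relations holding in both directions. -}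

module Defs where

open import Level using (0ℓ)
open import Data.Nat as ℕ using (ℕ; zero; suc)
open import Data.Integer as ℤ using (ℤ; _≤_; _⊔_; _⊓_; 0ℤ)
open import Data.Fin using (Fin; zero; suc; _≟_)
open import Data.List using (List; []; _∷_; _++_; map; concatMap; allFin)
open import Data.Nat.ListAction using (sum)
open import Data.List.Relation.Unary.All using (All)
open import Data.Maybe using (Maybe; just; nothing)
open import Data.Product using (Σ; _×_)
open import Data.Unit using (⊤)
open import Relation.Nullary using (yes; no)
open import Relation.Unary using (Pred; _∈_; U)
open import Relation.Binary.PropositionalEquality using (_≡_)

-- Raw games: a number, or ⟨ L ∣ R ⟩ with finite lists of options.
-- (Nonemptiness of option lists and temper are imposed by the
-- predicate W below.)

data Game : Set where
  num : ℤ → Game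
  ⟨_∣_⟩ : List Game → List Game → Game

data Parity : Set where
  even odd : Parity

flipP : Parity → Parity
flipP even = odd
flipP odd  = even

data NonEmpty {A : Set} : List A → Set where
  nonEmpty : ∀ x xs → NonEmpty (x ∷ xs)

-- W S p G : G is a p-tempered S-valued game.
data W (S : Pred ℤ 0ℓ) : Parity → Game → Set where
  wnum : ∀ {n} → n ∈ S → W S even (num n)
  wopt : ∀ {p gl gr} → NonEmpty gl → NonEmpty gr
       → All (W S (flipP p)) gl → All (W S (flipP p)) gr
       → W S p ⟨ gl ∣ gr ⟩

InW : Pred ℤ 0ℓ → Game → Set
InW S G = Σ Parity (λ p → W S p G)

-- Parity of a game (meaningful for well-tempered games).
parity : Game → Parity
parity (num _) = even
parity ⟨ g ∷ _ ∣ _ ⟩ = flipP (parity g)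
parity ⟨ [] ∣ _ ⟩ = even  -- junk, never occurs for games in 𝒲_S

mutual
  Lo : Game → ℤ
  Lo (num n) = n
  Lo ⟨ gl ∣ _ ⟩ = maxR gl

  Ro : Game → ℤ
  Ro (num n) = n
  Ro ⟨ _ ∣ gr ⟩ = minL gr

  -- max of R over a (nonempty) list; value on [] is junk
  maxR : List Game → ℤ
  maxR [] = 0ℤ
  maxR (g ∷ []) = Ro g
  maxR (g ∷ g′ ∷ gs) = Ro g ⊔ maxR (g′ ∷ gs)

  -- min of L over a (nonempty) list; value on [] is junk
  minL : List Game → ℤ
  minL [] = 0ℤ
  minL (g ∷ []) = Lo g
  minL (g ∷ g′ ∷ gs) = Lo g ⊓ minL (g′ ∷ gs)

infixl 6 _+_

mutual
  _+_ : Game → Game → Game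
  num a + num b = num (a ℤ.+ b)
  G@(num a) + ⟨ hl ∣ hr ⟩ = ⟨ addR G hl ∣ addR G hr ⟩
  ⟨ gl ∣ gr ⟩ + H@(num b) = ⟨ addL gl H ∣ addL gr H ⟩
  G@(⟨ gl ∣ gr ⟩) + H@(⟨ hl ∣ hr ⟩) =
    ⟨ addL gl H ++ addR G hl ∣ addL gr H ++ addR G hr ⟩

  addL : List Game → Game → List Game
  addL [] H = []
  addL (g ∷ gs) H = (g + H) ∷ addL gs H

  addR : Game → List Game → List Game
  addR G [] = []
  addR G (h ∷ hs) = (G + h) ∷ addR G hs

leftOpts : Game → List Game
leftOpts (num _) = []
leftOpts ⟨ gl ∣ _ ⟩ = gl

rightOpts : Game → List Game
rightOpts (num _) = []
rightOpts ⟨ _ ∣ gr ⟩ = gr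

asNum : Game → Maybe ℤ
asNum (num n) = just n
asNum ⟨ _ ∣ _ ⟩ = nothing

allNum : ∀ {k} → (Fin k → Game) → Maybe (Fin k → ℤ)
allNum {zero} G = just (λ ())
allNum {suc k} G with asNum (G zero) | allNum (λ i → G (suc i))
... | just n | just ns = just (λ { zero → n ; (suc i) → ns i })
... | _ | _ = nothing

update : ∀ {k} → (Fin k → Game) → Fin k → Game → (Fin k → Game)
update G i g j with i ≟ j
... | yes _ = g
... | no _  = G j

mutual
  depth : Game → ℕ
  depth (num _) = 0
  depth ⟨ gl ∣ gr ⟩ = suc (maxDepth gl ℕ.⊔ maxDepth gr)

  maxDepth : List Game → ℕ
  maxDepth [] = 0
  maxDepth (g ∷ gs) = depth g ℕ.⊔ maxDepth gs

-- fuel-driven definition of the extension; fuel only ensures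
-- termination (each move lowers the sum of depths by ≥ 1)
extFuel : ∀ {k} → ((Fin k → ℤ) → ℤ) → ℕ → (Fin k → Game) → Game
extFuel f zero G = num 0ℤ  -- unreachable with sufficient fuel
extFuel {k} f (suc n) G with allNum G
... | just a = num (f a)
... | nothing =
  ⟨ concatMap (λ i → map (λ g → extFuel f n (update G i g)) (leftOpts (G i))) (allFin k)
  ∣ concatMap (λ i → map (λ g → extFuel f n (update G i g)) (rightOpts (G i))) (allFin k) ⟩

ext : ∀ {k} → ((Fin k → ℤ) → ℤ) → (Fin k → Game) → Game
ext {k} f G = extFuel f (suc (sum (map (λ i → depth (G i)) (allFin k)))) G

lf : Game → ℤ
lf G with parity G
... | odd  = Lo G
... | even = Ro G

rf : Game → ℤ
rf G with parity G
... | odd  = Ro G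
... | even = Lo G

_≲_ : Game → Game → Set
G ≲ H = ∀ X → InW U X → (Lo (G + X) ≤ Lo (H + X)) × (Ro (G + X) ≤ Ro (H + X))

-- ≲₊ and ≲₋ are defined for games of the same parity; we include
-- the same-parity requirement in the relation.
_≲₊_ : Game → Game → Set
G ≲₊ H = (parity G ≡ parity H) × (∀ X → InW U X → lf (G + X) ≤ lf (H + X))

_≲₋_ : Game → Game → Set
G ≲₋ H = (parity G ≡ parity H) × (∀ X → InW U X → rf (G + X) ≤ rf (H + X))

data Rel : Set where
  `≲ `≳ `≲₊ `≲₋ `≳₊ `≳₋ `≈ `≈₊ `≈₋ : Rel

⟦_⟧ : Rel → Game → Game → Set
⟦ `≲ ⟧ G H = G ≲ H
⟦ `≳ ⟧ G H = H ≲ G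
⟦ `≲₊ ⟧ G H = G ≲₊ H
⟦ `≲₋ ⟧ G H = G ≲₋ H
⟦ `≳₊ ⟧ G H = H ≲₊ G
⟦ `≳₋ ⟧ G H = H ≲₋ G
⟦ `≈ ⟧ G H = (G ≲ H) × (H ≲ G)
⟦ `≈₊ ⟧ G H = (G ≲₊ H) × (H ≲₊ G)
⟦ `≈₋ ⟧ G H = (G ≲₋ H) × (H ≲₋ G)

OrderPreserving : ∀ {k} → (Fin k → Pred ℤ 0ℓ) → ((Fin k → ℤ) → ℤ) → Set
OrderPreserving {k} S f =
  ∀ a b → (∀ i → a i ∈ S i) → (∀ i → b i ∈ S i) →
  (∀ i → a i ≤ b i) → f a ≤ f b

module Submission where

-- Tuples are changed one component at a time (hybrid argument), so the
-- heart is the case where K and K′ differ only in component i.  Fix an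
-- opponent X and a cut c ∈ ℤ.  From the finite set V of values of K i and
-- K′ i we build an auxiliary payoff φ with the following property: for
-- Z = φ̃(K[i ≔ X]), the sum f̃(K) + X is c-similar to K i + Z, and
-- f̃(K′) + X to K′ i + Z.  Here c-similarity is a move-for-move matching of
-- game trees whose matched leaves lie on the same side of c; it transports
-- the cuts c ≤ Lo, Ro, lf, rf.  Taking c to be the value of f̃(K) + X and
-- comparing K i + Z with K′ i + Z by hypothesis yields the comparison of
-- f̃(K) + X with f̃(K′) + X.

open import Defs
open import Level using (0ℓ)
open import Data.Nat using (ℕ)
open import Data.Integer using (ℤ)
open import Data.Fin using (Fin)
open import Relation.Unary using (Pred; _∈_)

open import Data.Nat as ℕ using (zero; suc)
import Data.Nat.Properties as ℕP
open import Data.Nat.ListAction using (sum)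
open import Data.Integer as ℤ using (_≤_; _⊔_; _⊓_; 0ℤ; _-_; -_)
import Data.Integer.Properties as ℤP
open import Data.Integer.Tactic.RingSolver using (solve-∀)
open import Data.Fin using (zero; suc; toℕ; fromℕ<) renaming (_≟_ to _≟ᶠ_)
import Data.Fin.Properties as FinP
open import Data.List using (List; []; _∷_; _++_; map; concatMap; allFin; tabulate)
open import Data.List.Properties using (++-identityʳ; map-tabulate; tabulate-cong)
open import Data.List.Membership.Propositional using (find; lose) renaming (_∈_ to _∈ᴸ_)
open import Data.List.Membership.Propositional.Properties
  using (∈-++⁺ˡ; ∈-++⁺ʳ; ∈-++⁻; ∈-map⁺; ∈-map⁻; ∈-concatMap⁺; ∈-concatMap⁻; ∈-allFin)
open import Data.List.Relation.Unary.Any using (here; there)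
open import Data.List.Relation.Unary.All as All using (All; []; _∷_)
import Data.List.Relation.Unary.All.Properties as AllP
open import Data.Maybe using (just; nothing)
open import Data.Product using (_×_; _,_; proj₁; proj₂; ∃-syntax)
open import Data.Sum using (_⊎_; inj₁; inj₂)
open import Data.Empty using (⊥; ⊥-elim)
open import Data.Unit using (⊤; tt)
open import Data.Vec.Functional using (updateAt)
open import Data.Vec.Functional.Properties using (updateAt-updates; updateAt-minimal)
open import Function using (id; const; _∘_; _⇔_; mk⇔; Equivalence)
open import Function.Construct.Composition using (_⇔-∘_)
open import Function.Construct.Symmetry using (⇔-sym)
open import Relation.Nullary using (yes; no; ¬_; contradiction)
open import Relation.Unary using (U; Decidable)
open import Relation.Binary.PropositionalEquality

UpClosedOn : Pred ℤ 0ℓ → List ℤ → Set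
UpClosedOn P V = ∀ {a b} → a ∈ᴸ V → b ∈ᴸ V → a ≤ b → P a → P b

threshold : {P : Pred ℤ 0ℓ} → Decidable P → List ℤ → ℤ
threshold P? [] = 0ℤ
threshold P? (v ∷ vs) with P? v
... | yes _ = v ⊓ threshold P? vs
... | no  _ = threshold P? vs ⊔ ℤ.suc v

threshold-spec : ∀ {P} (P? : Decidable P) V → UpClosedOn P V →
                 ∀ {a} → a ∈ᴸ V → P a ⇔ threshold P? V ≤ a
threshold-spec {P} P? (v ∷ vs) up {a} a∈V with P? v | a∈V
... | yes Pv | here refl = mk⇔ (λ _ → ℤP.i⊓j≤i v _) (λ _ → Pv)
... | no ¬Pv | here refl = mk⇔ (λ Pv → contradiction Pv ¬Pv) above
  where
  above : threshold P? vs ⊔ ℤ.suc v ≤ v → P v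
  above h = contradiction (ℤP.suc[i]≤j⇒i<j (ℤP.≤-trans (ℤP.i≤j⊔i _ _) h)) (ℤP.<-irrefl refl)
... | yes Pv | there a∈vs = mk⇔ (λ Pa → ℤP.≤-trans (ℤP.i⊓j≤j v _) (Equivalence.to IH Pa)) from
  where
  IH : P a ⇔ threshold P? vs ≤ a
  IH = threshold-spec P? vs (λ x y → up (there x) (there y)) a∈vs
  from : v ⊓ threshold P? vs ≤ a → P a
  from h with ℤP.⊓-sel v (threshold P? vs)
  ... | inj₁ e = up (here refl) (there a∈vs) (subst (_≤ a) e h) Pv
  ... | inj₂ e = Equivalence.from IH (subst (_≤ a) e h)
... | no ¬Pv | there a∈vs =
  mk⇔ (λ Pa → ℤP.⊔-lub (Equivalence.to IH Pa) (ℤP.i<j⇒suc[i]≤j (v<a Pa)))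
      (λ h → Equivalence.from IH (ℤP.≤-trans (ℤP.i≤i⊔j _ _) h))
  where
  IH : P a ⇔ threshold P? vs ≤ a
  IH = threshold-spec P? vs (λ x y → up (there x) (there y)) a∈vs
  v<a : P a → v ℤ.< a
  v<a Pa = ℤP.≰⇒> (λ a≤v → ¬Pv (up (there a∈vs) (here refl) a≤v Pa))

+-cancelˡ-≤ : ∀ c {x y} → c ℤ.+ x ≤ c ℤ.+ y → x ≤ y
+-cancelˡ-≤ c {x} {y} h = subst₂ _≤_ (cancel x) (cancel y) (ℤP.+-monoʳ-≤ (- c) h)
  where
  cancel : ∀ z → - c ℤ.+ (c ℤ.+ z) ≡ z
  cancel z = trans (sym (ℤP.+-assoc (- c) c z)) (trans (cong (ℤ._+ z) (ℤP.+-inverseˡ c)) (ℤP.+-identityˡ z))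

swap-shift : ∀ a c t → a ℤ.+ (c - t) ≡ c ℤ.+ (a - t)
swap-shift = solve-∀

shift-cut : ∀ c a t → c ≤ a ℤ.+ (c - t) ⇔ t ≤ a
shift-cut c a t rewrite swap-shift a c t =
  mk⇔ (λ h → ℤP.0≤i-j⇒j≤i (+-cancelˡ-≤ c (subst (_≤ c ℤ.+ (a - t)) (sym (ℤP.+-identityʳ c)) h)))
      (λ h → subst (_≤ c ℤ.+ (a - t)) (ℤP.+-identityʳ c) (ℤP.+-monoʳ-≤ c (ℤP.i≤j⇒0≤j-i h)))

data Side : Set where
  left right : Side

opts : Side → Game → List Game
opts left  = leftOpts
opts right = rightOpts

IsNode : Game → Set
IsNode (num _)   = ⊥
IsNode ⟨ _ ∣ _ ⟩ = ⊤

addL≡map : ∀ gs H → addL gs H ≡ map (_+ H) gs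
addL≡map []       H = refl
addL≡map (g ∷ gs) H = cong (g + H ∷_) (addL≡map gs H)

addR≡map : ∀ G hs → addR G hs ≡ map (G +_) hs
addR≡map G []       = refl
addR≡map G (h ∷ hs) = cong (G + h ∷_) (addR≡map G hs)

opts-+ : ∀ s G H → opts s (G + H) ≡ map (_+ H) (opts s G) ++ map (G +_) (opts s H)
opts-+ left  (num a) (num b) = refl
opts-+ right (num a) (num b) = refl
opts-+ left  (num a) ⟨ hl ∣ hr ⟩ = addR≡map _ hl
opts-+ right (num a) ⟨ hl ∣ hr ⟩ = addR≡map _ hr
opts-+ left  ⟨ gl ∣ gr ⟩ (num b) = trans (addL≡map gl _) (sym (++-identityʳ _))
opts-+ right ⟨ gl ∣ gr ⟩ (num b) = trans (addL≡map gr _) (sym (++-identityʳ _))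
opts-+ left  ⟨ gl ∣ gr ⟩ ⟨ hl ∣ hr ⟩ = cong₂ _++_ (addL≡map gl _) (addR≡map _ hl)
opts-+ right ⟨ gl ∣ gr ⟩ ⟨ hl ∣ hr ⟩ = cong₂ _++_ (addL≡map gr _) (addR≡map _ hr)

∈-+⁻ : ∀ s G H {x} → x ∈ᴸ opts s (G + H) →
       (∃[ g ] g ∈ᴸ opts s G × x ≡ g + H) ⊎ (∃[ h ] h ∈ᴸ opts s H × x ≡ G + h)
∈-+⁻ s G H x∈ with ∈-++⁻ (map (_+ H) (opts s G)) (subst (_ ∈ᴸ_) (opts-+ s G H) x∈)
... | inj₁ x∈ˡ = inj₁ (∈-map⁻ (_+ H) x∈ˡ)
... | inj₂ x∈ʳ = inj₂ (∈-map⁻ (G +_) x∈ʳ)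

∈-+⁺ˡ : ∀ s G H {g} → g ∈ᴸ opts s G → g + H ∈ᴸ opts s (G + H)
∈-+⁺ˡ s G H g∈ = subst (_ ∈ᴸ_) (sym (opts-+ s G H)) (∈-++⁺ˡ (∈-map⁺ (_+ H) g∈))

∈-+⁺ʳ : ∀ s G H {h} → h ∈ᴸ opts s H → G + h ∈ᴸ opts s (G + H)
∈-+⁺ʳ s G H h∈ = subst (_ ∈ᴸ_) (sym (opts-+ s G H)) (∈-++⁺ʳ (map (_+ H) (opts s G)) (∈-map⁺ (G +_) h∈))

+-node : ∀ G H → IsNode G ⊎ IsNode H → IsNode (G + H)
+-node (num a)   (num b)   (inj₁ ())
+-node (num a)   (num b)   (inj₂ ())
+-node (num a)   ⟨ _ ∣ _ ⟩ _ = tt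
+-node ⟨ _ ∣ _ ⟩ (num b)   _ = tt
+-node ⟨ _ ∣ _ ⟩ ⟨ _ ∣ _ ⟩ _ = tt

mutual
  leaves : Game → List ℤ
  leaves (num a)     = a ∷ []
  leaves ⟨ gl ∣ gr ⟩ = leavesL gl ++ leavesL gr

  leavesL : List Game → List ℤ
  leavesL []       = []
  leavesL (g ∷ gs) = leaves g ++ leavesL gs

num-no-opts : ∀ s {a g} → g ∈ᴸ opts s (num a) → ⊥
num-no-opts left  ()
num-no-opts right ()

AllLeaves : (ℤ → Set) → Game → Set
AllLeaves Q G = ∀ {a} → a ∈ᴸ leaves G → Q a

leavesL-⊇ : ∀ {g a} gs → g ∈ᴸ gs → a ∈ᴸ leaves g → a ∈ᴸ leavesL gs
leavesL-⊇ (g ∷ gs) (here refl) a∈ = ∈-++⁺ˡ a∈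
leavesL-⊇ (g ∷ gs) (there g∈)  a∈ = ∈-++⁺ʳ (leaves g) (leavesL-⊇ gs g∈ a∈)

leaves-opt : ∀ s G {g a} → g ∈ᴸ opts s G → a ∈ᴸ leaves g → a ∈ᴸ leaves G
leaves-opt left  ⟨ gl ∣ gr ⟩ g∈ a∈ = ∈-++⁺ˡ (leavesL-⊇ gl g∈ a∈)
leaves-opt right ⟨ gl ∣ gr ⟩ g∈ a∈ = ∈-++⁺ʳ (leavesL gl) (leavesL-⊇ gr g∈ a∈)

AllLeaves-opt : ∀ {Q} s G {g} → AllLeaves Q G → g ∈ᴸ opts s G → AllLeaves Q g
AllLeaves-opt s G all g∈ a∈ = all (leaves-opt s G g∈ a∈)

_⊕_ : Parity → Parity → Parity
even ⊕ q = q
odd  ⊕ q = flipP q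

flipP-involutive : ∀ p → flipP (flipP p) ≡ p
flipP-involutive even = refl
flipP-involutive odd  = refl

flipP-injective : ∀ {p q} → flipP p ≡ flipP q → p ≡ q
flipP-injective {p} {q} e = trans (sym (flipP-involutive p)) (trans (cong flipP e) (flipP-involutive q))

flipP-⊕ : ∀ p q → flipP p ⊕ q ≡ flipP (p ⊕ q)
flipP-⊕ even q = refl
flipP-⊕ odd  q = sym (flipP-involutive q)

⊕-flipP : ∀ p q → p ⊕ flipP q ≡ flipP (p ⊕ q)
⊕-flipP even q = refl
⊕-flipP odd  q = refl

W-parity : ∀ {S p G} → W S p G → parity G ≡ p
W-parity (wnum _) = refl
W-parity (wopt (nonEmpty _ _) _ (w ∷ _) _) = trans (cong flipP (W-parity w)) (flipP-involutive _)

mutual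
  W-⊆ : ∀ {S S′ : Pred ℤ 0ℓ} {p G} → (∀ {a} → a ∈ S → a ∈ S′) → W S p G → W S′ p G
  W-⊆ S⊆ (wnum a∈)       = wnum (S⊆ a∈)
  W-⊆ S⊆ (wopt nl nr l r) = wopt nl nr (W-⊆ᴬ S⊆ l) (W-⊆ᴬ S⊆ r)

  W-⊆ᴬ : ∀ {S S′ : Pred ℤ 0ℓ} {p gs} → (∀ {a} → a ∈ S → a ∈ S′) → All (W S p) gs → All (W S′ p) gs
  W-⊆ᴬ S⊆ []       = []
  W-⊆ᴬ S⊆ (w ∷ ws) = W-⊆ S⊆ w ∷ W-⊆ᴬ S⊆ ws

W-U : ∀ {S p G} → W S p G → W U p G
W-U = W-⊆ (λ _ → tt)

W-opt : ∀ {S p G} s {g} → W S p G → g ∈ᴸ opts s G → W S (flipP p) g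
W-opt left  (wopt _ _ l _) g∈ = All.lookup l g∈
W-opt right (wopt _ _ _ r) g∈ = All.lookup r g∈

W-opt-exists : ∀ {S p G} s → W S p G → IsNode G → ∃[ g ] g ∈ᴸ opts s G
W-opt-exists left  (wopt (nonEmpty g _) _ _ _) _ = g , here refl
W-opt-exists right (wopt _ (nonEmpty g _) _ _) _ = g , here refl

mutual
  W-leaves : ∀ {S p G} → W S p G → AllLeaves (_∈ S) G
  W-leaves (wnum a∈) (here refl) = a∈
  W-leaves {G = ⟨ gl ∣ _ ⟩} (wopt _ _ l r) a∈ with ∈-++⁻ (leavesL gl) a∈
  ... | inj₁ a∈ˡ = W-leavesᴬ l a∈ˡ
  ... | inj₂ a∈ʳ = W-leavesᴬ r a∈ʳ

  W-leavesᴬ : ∀ {S p gs a} → All (W S p) gs → a ∈ᴸ leavesL gs → a ∈ S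
  W-leavesᴬ {gs = g ∷ _} (w ∷ ws) a∈ with ∈-++⁻ (leaves g) a∈
  ... | inj₁ a∈g  = W-leaves w a∈g
  ... | inj₂ a∈gs = W-leavesᴬ ws a∈gs

mutual
  W-+ : ∀ {p q G H} → W U p G → W U q H → W U (p ⊕ q) (G + H)
  W-+ (wnum _) (wnum _) = wnum tt
  W-+ wg@(wnum _) (wopt (nonEmpty _ _) (nonEmpty _ _) l r) =
    wopt (nonEmpty _ _) (nonEmpty _ _) (W-addR wg l) (W-addR wg r)
  W-+ (wopt (nonEmpty _ _) (nonEmpty _ _) l r) wh@(wnum _) =
    wopt (nonEmpty _ _) (nonEmpty _ _) (W-addL l wh) (W-addL r wh)
  W-+ wg@(wopt (nonEmpty _ _) (nonEmpty _ _) gl gr) wh@(wopt (nonEmpty _ _) (nonEmpty _ _) hl hr) =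
    wopt (nonEmpty _ _) (nonEmpty _ _) (AllP.++⁺ (W-addL gl wh) (W-addR wg hl))
                                       (AllP.++⁺ (W-addL gr wh) (W-addR wg hr))

  W-addR : ∀ {p q G hs} → W U p G → All (W U (flipP q)) hs → All (W U (flipP (p ⊕ q))) (addR G hs)
  W-addR wg []       = []
  W-addR {p} {q} wg (w ∷ ws) = subst (λ r → W U r _) (⊕-flipP p q) (W-+ wg w) ∷ W-addR wg ws

  W-addL : ∀ {p q gs H} → All (W U (flipP p)) gs → W U q H → All (W U (flipP (p ⊕ q))) (addL gs H)
  W-addL []       wh = []
  W-addL {p} {q} (w ∷ ws) wh = subst (λ r → W U r _) (flipP-⊕ p q) (W-+ w wh) ∷ W-addL ws wh

InW-+ : ∀ {G H} → InW U G → InW U H → InW U (G + H)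
InW-+ (_ , wg) (_ , wh) = _ , W-+ wg wh

update-same : ∀ {k} (K : Fin k → Game) j g → update K j g j ≡ g
update-same K j g with j ≟ᶠ j
... | yes _ = refl
... | no j≢j = ⊥-elim (j≢j refl)

update-other : ∀ {k} (K : Fin k → Game) j g l → j ≢ l → update K j g l ≡ K l
update-other K j g l j≢l with j ≟ᶠ l
... | yes j≡l = ⊥-elim (j≢l j≡l)
... | no _    = refl

update-pointwise : ∀ {k} (P : Fin k → Game → Set) (K : Fin k → Game) j g →
                   (∀ l → P l (K l)) → P j g → ∀ l → P l (update K j g l)
update-pointwise P K j g all Pg l with j ≟ᶠ l
... | yes refl = Pg
... | no _     = all l

asNum-just : ∀ G {a} → asNum G ≡ just a → G ≡ num a
asNum-just (num _)   refl = refl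
asNum-just ⟨ _ ∣ _ ⟩ ()

asNum-nothing : ∀ G → asNum G ≡ nothing → IsNode G
asNum-nothing (num _)   ()
asNum-nothing ⟨ _ ∣ _ ⟩ _ = tt

allNum-just : ∀ {k} (K : Fin k → Game) {a} → allNum K ≡ just a → ∀ j → K j ≡ num (a j)
allNum-just {suc k} K eq j with asNum (K zero) in e₀ | allNum (λ l → K (suc l)) in e₁
allNum-just {suc k} K refl zero    | just _ | just _ = asNum-just (K zero) e₀
allNum-just {suc k} K refl (suc j) | just _ | just _ = allNum-just (λ l → K (suc l)) e₁ j
allNum-just {suc k} K ()   _       | just _ | nothing
allNum-just {suc k} K ()   _       | nothing | _

allNum-nothing : ∀ {k} (K : Fin k → Game) → allNum K ≡ nothing → ∃[ j ] IsNode (K j)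
allNum-nothing {suc k} K eq with asNum (K zero) in e₀ | allNum (λ l → K (suc l)) in e₁
allNum-nothing {suc k} K () | just _ | just _
... | just _  | nothing = let (j , node) = allNum-nothing (λ l → K (suc l)) e₁ in suc j , node
... | nothing | _       = zero , asNum-nothing (K zero) e₀

maxDepth-≥ : ∀ {g} gs → g ∈ᴸ gs → depth g ℕ.≤ maxDepth gs
maxDepth-≥ (g ∷ gs) (here refl) = ℕP.m≤m⊔n _ _
maxDepth-≥ (g ∷ gs) (there g∈)  = ℕP.m≤n⇒m≤o⊔n (depth g) (maxDepth-≥ gs g∈)

depth-opt : ∀ s G {g} → g ∈ᴸ opts s G → depth g ℕ.< depth G
depth-opt left  ⟨ gl ∣ gr ⟩ g∈ = ℕ.s≤s (ℕP.m≤n⇒m≤n⊔o (maxDepth gr) (maxDepth-≥ gl g∈))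
depth-opt right ⟨ gl ∣ gr ⟩ g∈ = ℕ.s≤s (ℕP.m≤n⇒m≤o⊔n (maxDepth gl) (maxDepth-≥ gr g∈))

sum-tabulate-< : ∀ {k} (h h′ : Fin k → ℕ) j → (∀ l → j ≢ l → h′ l ≡ h l) → h′ j ℕ.< h j →
                 sum (tabulate h′) ℕ.< sum (tabulate h)
sum-tabulate-< {suc k} h h′ zero others lt
  rewrite tabulate-cong {f = λ l → h′ (suc l)} (λ l → others (suc l) (λ ()))
  = ℕP.+-monoˡ-< _ lt
sum-tabulate-< {suc k} h h′ (suc j) others lt
  rewrite others zero (λ ())
  = ℕP.+-monoʳ-< (h zero) (sum-tabulate-< (λ l → h (suc l)) (λ l → h′ (suc l)) j
                              (λ l j≢l → others (suc l) (λ e → j≢l (FinP.suc-injective e))) lt)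

totalDepth : ∀ {k} → (Fin k → Game) → ℕ
totalDepth {k} K = sum (map (λ j → depth (K j)) (allFin k))

totalDepth-tabulate : ∀ {k} (K : Fin k → Game) → totalDepth K ≡ sum (tabulate (λ j → depth (K j)))
totalDepth-tabulate K = cong sum (map-tabulate id (λ j → depth (K j)))

-- n units of fuel suffice to evaluate f̃(K) completely.
Fuelled : ∀ {k} → ℕ → (Fin k → Game) → Set
Fuelled n K = totalDepth K ℕ.< n

fuelled-move : ∀ {k} n (K : Fin k → Game) s j {g} → Fuelled (suc n) K → g ∈ᴸ opts s (K j) →
               Fuelled n (update K j g)
fuelled-move n K s j {g} fuel g∈ = ℕP.<-≤-trans smaller (ℕP.≤-pred fuel)
  where
  shallower : depth (update K j g j) ℕ.< depth (K j)
  shallower = subst (λ x → depth x ℕ.< depth (K j)) (sym (update-same K j g)) (depth-opt s (K j) g∈)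
  smaller : totalDepth (update K j g) ℕ.< totalDepth K
  smaller = subst₂ ℕ._<_ (sym (totalDepth-tabulate (update K j g))) (sym (totalDepth-tabulate K))
              (sum-tabulate-< _ _ j (λ l j≢l → cong depth (update-other K j g l j≢l)) shallower)

parityΣ : ∀ {k} → (Fin k → Parity) → Parity
parityΣ {zero}  p = even
parityΣ {suc k} p = p zero ⊕ parityΣ (λ l → p (suc l))

parityΣ-cong : ∀ {k} (p p′ : Fin k → Parity) → (∀ j → p j ≡ p′ j) → parityΣ p ≡ parityΣ p′
parityΣ-cong {zero}  p p′ eq = refl
parityΣ-cong {suc k} p p′ eq = cong₂ _⊕_ (eq zero) (parityΣ-cong _ _ (λ l → eq (suc l)))

parityΣ-even : ∀ {k} (p : Fin k → Parity) → (∀ j → p j ≡ even) → parityΣ p ≡ even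
parityΣ-even {zero}  p evens = refl
parityΣ-even {suc k} p evens rewrite evens zero = parityΣ-even _ (λ l → evens (suc l))

parityΣ-flip : ∀ {k} (p p′ : Fin k → Parity) j → (∀ l → j ≢ l → p′ l ≡ p l) → p′ j ≡ flipP (p j) →
               parityΣ p′ ≡ flipP (parityΣ p)
parityΣ-flip {suc k} p p′ zero others flipped =
  trans (cong₂ _⊕_ flipped (parityΣ-cong _ _ (λ l → others (suc l) (λ ()))))
        (flipP-⊕ (p zero) _)
parityΣ-flip {suc k} p p′ (suc j) others flipped =
  trans (cong₂ _⊕_ (others zero (λ ()))
                   (parityΣ-flip (λ l → p (suc l)) (λ l → p′ (suc l)) j
                                 (λ l j≢l → others (suc l) (λ e → j≢l (FinP.suc-injective e))) flipped))
        (⊕-flipP (p zero) _)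

Tempered : Game → Set
Tempered G = W U (parity G) G

tempered : ∀ {S G} → InW S G → Tempered G
tempered (p , w) = subst (λ q → W U q _) (sym (W-parity w)) (W-U w)

tempered-opt : ∀ s {G g} → Tempered G → g ∈ᴸ opts s G → Tempered g × parity g ≡ flipP (parity G)
tempered-opt s w g∈ = tempered (_ , W-opt s w g∈) , W-parity (W-opt s w g∈)

nonEmpty-∈ : ∀ {A : Set} {x : A} {xs} → x ∈ᴸ xs → NonEmpty xs
nonEmpty-∈ {xs = y ∷ ys} _ = nonEmpty y ys

W-node : ∀ {p} G → IsNode G → (∀ s → ∃[ g ] g ∈ᴸ opts s G) →
         (∀ s {g} → g ∈ᴸ opts s G → W U (flipP p) g) → W U p G
W-node ⟨ gl ∣ gr ⟩ _ exists all =
  wopt (nonEmpty-∈ (proj₂ (exists left))) (nonEmpty-∈ (proj₂ (exists right)))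
       (All.tabulate (all left)) (All.tabulate (all right))

data Shape {k} (K : Fin k → Game) : Set where
  allNumbers : ∀ a → allNum K ≡ just a → Shape K
  someNode   : ∀ j → IsNode (K j) → Shape K

shape : ∀ {k} (K : Fin k → Game) → Shape K
shape K with allNum K in eq
... | just a  = allNumbers a eq
... | nothing = let (j , isNode) = allNum-nothing K eq in someNode j isNode

module Extension {k : ℕ} (f : (Fin k → ℤ) → ℤ) where

  moves : Side → ℕ → (Fin k → Game) → Fin k → List Game
  moves s n K j = map (λ g → extFuel f n (update K j g)) (opts s (K j))

  extOpts : Side → ℕ → (Fin k → Game) → List Game
  extOpts s n K = concatMap (moves s n K) (allFin k)

  opts-node : ∀ s n K → opts s ⟨ extOpts left n K ∣ extOpts right n K ⟩ ≡ extOpts s n K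
  opts-node left  n K = refl
  opts-node right n K = refl

  ExtMove : Side → ℕ → (Fin k → Game) → Game → Set
  ExtMove s n K x = ∃[ j ] ∃[ g ] g ∈ᴸ opts s (K j) × x ≡ extFuel f n (update K j g)

  ∈-ext⁻ : ∀ s n K {x} → x ∈ᴸ opts s (extFuel f (suc n) K) → ExtMove s n K x
  ∈-ext⁻ s n K x∈ with allNum K
  ∈-ext⁻ left  n K () | just _
  ∈-ext⁻ right n K () | just _
  ... | nothing with find (∈-concatMap⁻ (moves s n K) {allFin k} (subst (_ ∈ᴸ_) (opts-node s n K) x∈))
  ...   | j , _ , x∈ʲ with ∈-map⁻ _ x∈ʲ
  ...     | g , g∈ , x≡ = j , g , g∈ , x≡

  ∈-ext⁺ : ∀ s n K j {g} → g ∈ᴸ opts s (K j) → extFuel f n (update K j g) ∈ᴸ opts s (extFuel f (suc n) K)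
  ∈-ext⁺ s n K j {g} g∈ with allNum K in eq
  ... | just a  = ⊥-elim (subst (λ G → g ∈ᴸ opts s G → ⊥) (sym (allNum-just K eq j)) (num-no-opts s) g∈)
  ... | nothing = subst (_ ∈ᴸ_) (sym (opts-node s n K))
                    (∈-concatMap⁺ (moves s n K) (lose (∈-allFin j) (∈-map⁺ (λ g → extFuel f n (update K j g)) g∈)))

  ext-node : ∀ n K j → IsNode (K j) → IsNode (extFuel f (suc n) K)
  ext-node n K j isNode with allNum K in eq
  ... | just a  = subst IsNode (allNum-just K eq j) isNode
  ... | nothing = tt

  ext-leaf : ∀ n K {a} → allNum K ≡ just a → extFuel f (suc n) K ≡ num (f a)
  ext-leaf n K eq rewrite eq = refl

  ext-tempered : ∀ n K → (∀ j → Tempered (K j)) → Fuelled n K →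
                 W U (parityΣ (λ j → parity (K j))) (extFuel f n K)
  ext-tempered (suc n) K temp fuel with shape K
  ... | allNumbers a eq =
    subst₂ (W U) (sym (parityΣ-even _ (λ j → cong parity (allNum-just K eq j)))) (sym (ext-leaf n K eq)) (wnum tt)
  ... | someNode j₀ isNode = W-node _ (ext-node n K j₀ isNode) exists option
    where
    exists : ∀ s → ∃[ g ] g ∈ᴸ opts s (extFuel f (suc n) K)
    exists s = let (g , g∈) = W-opt-exists s (temp j₀) isNode in _ , ∈-ext⁺ s n K j₀ g∈
    option : ∀ s {x} → x ∈ᴸ opts s (extFuel f (suc n) K) → W U (flipP (parityΣ (λ j → parity (K j)))) x
    option s x∈ with ∈-ext⁻ s n K x∈
    ... | j , g , g∈ , refl =
      subst (λ p → W U p (extFuel f n (update K j g)))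
        (parityΣ-flip _ _ j (λ l j≢l → cong parity (update-other K j g l j≢l))
                            (trans (cong parity (update-same K j g)) (proj₂ (tempered-opt s (temp j) g∈))))
        (ext-tempered n (update K j g)
          (update-pointwise (λ _ G → Tempered G) K j g temp (proj₁ (tempered-opt s (temp j) g∈)))
          (fuelled-move n K s j fuel g∈))

  ext-InW : ∀ K → (∀ j → Tempered (K j)) → InW U (ext f K)
  ext-InW K temp = _ , ext-tempered _ K temp ℕP.≤-refl

  ext-parity : ∀ K → (∀ j → Tempered (K j)) → parity (ext f K) ≡ parityΣ (λ j → parity (K j))
  ext-parity K temp = W-parity (ext-tempered _ K temp ℕP.≤-refl)
maxR-≥ : ∀ {g} gs → g ∈ᴸ gs → Ro g ≤ maxR gs
maxR-≥ (g ∷ [])      (here refl) = ℤP.≤-refl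
maxR-≥ (g ∷ _ ∷ _)   (here refl) = ℤP.i≤i⊔j _ _
maxR-≥ (g ∷ g′ ∷ gs) (there m)   = ℤP.≤-trans (maxR-≥ (g′ ∷ gs) m) (ℤP.i≤j⊔i _ _)

maxR-attained : ∀ {c} g gs → c ≤ maxR (g ∷ gs) → ∃[ g′ ] g′ ∈ᴸ g ∷ gs × c ≤ Ro g′
maxR-attained g []        h = g , here refl , h
maxR-attained g (g′ ∷ gs) h with ℤP.⊔-sel (Ro g) (maxR (g′ ∷ gs))
... | inj₁ e = g , here refl , subst (_ ≤_) e h
... | inj₂ e with maxR-attained g′ gs (subst (_ ≤_) e h)
...   | x , x∈ , hx = x , there x∈ , hx

minL-≤ : ∀ {g} gs → g ∈ᴸ gs → minL gs ≤ Lo g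
minL-≤ (g ∷ [])      (here refl) = ℤP.≤-refl
minL-≤ (g ∷ _ ∷ _)   (here refl) = ℤP.i⊓j≤i _ _
minL-≤ (g ∷ g′ ∷ gs) (there m)   = ℤP.≤-trans (ℤP.i⊓j≤j _ _) (minL-≤ (g′ ∷ gs) m)

minL-glb : ∀ {c} g gs → (∀ {x} → x ∈ᴸ g ∷ gs → c ≤ Lo x) → c ≤ minL (g ∷ gs)
minL-glb g []        h = h (here refl)
minL-glb g (g′ ∷ gs) h = ℤP.⊓-glb (h (here refl)) (minL-glb g′ gs (λ m → h (there m)))

maxR-transfer : ∀ {c} gs hs →
  (∀ {g} → g ∈ᴸ gs → ∃[ h ] h ∈ᴸ hs × (c ≤ Ro g → c ≤ Ro h)) →
  (∀ {h} → h ∈ᴸ hs → ∃[ g ] g ∈ᴸ gs) →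
  c ≤ maxR gs → c ≤ maxR hs
maxR-transfer []       []      _     _    h = h
maxR-transfer []       (_ ∷ _) _     back _ with back (here refl)
... | _ , ()
maxR-transfer (g ∷ gs) hs      forth _    h with maxR-attained g gs h
... | g′ , g′∈ , hg′ with forth g′∈
...   | h′ , h′∈ , carry = ℤP.≤-trans (carry hg′) (maxR-≥ hs h′∈)

minL-transfer : ∀ {c} gs hs →
  (∀ {g} → g ∈ᴸ gs → ∃[ h ] h ∈ᴸ hs) →
  (∀ {h} → h ∈ᴸ hs → ∃[ g ] g ∈ᴸ gs × (c ≤ Lo g → c ≤ Lo h)) →
  c ≤ minL gs → c ≤ minL hs
minL-transfer []      []       _     _    h = h
minL-transfer (_ ∷ _) []       forth _    _ with forth (here refl)
... | _ , ()
minL-transfer {c} gs (h ∷ hs) _ back c≤ = minL-glb h hs bound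
  where
  bound : ∀ {x} → x ∈ᴸ h ∷ hs → c ≤ Lo x
  bound x∈ with back x∈
  ... | g , g∈ , carry = carry (ℤP.≤-trans c≤ (minL-≤ gs g∈))

record BackAndForth (R : Game → Game → Set) (G H : Game) : Set where
  field
    forth : ∀ s {g} → g ∈ᴸ opts s G → ∃[ h ] h ∈ᴸ opts s H × R g h
    back  : ∀ s {h} → h ∈ᴸ opts s H → ∃[ g ] g ∈ᴸ opts s G × R g h

data Sim (c : ℤ) : Game → Game → Set where
  leaf : ∀ {a b} → (c ≤ a ⇔ c ≤ b) → Sim c (num a) (num b)
  node : ∀ {G H} → IsNode G → IsNode H → BackAndForth (Sim c) G H → Sim c G H

mutual
  sim-Lo : ∀ {c G H} → Sim c G H → c ≤ Lo G → c ≤ Lo H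
  sim-Lo (leaf a⇔b) = Equivalence.to a⇔b
  sim-Lo (node {⟨ gl ∣ _ ⟩} {⟨ hl ∣ _ ⟩} _ _ bf) =
    maxR-transfer gl hl (λ m → carryRo (BackAndForth.forth bf left m))
                        (λ m → let (g , g∈ , _) = BackAndForth.back bf left m in g , g∈)
    where
    carryRo : ∀ {c g hs} → ∃[ h ] h ∈ᴸ hs × Sim c g h → ∃[ h ] h ∈ᴸ hs × (c ≤ Ro g → c ≤ Ro h)
    carryRo (h , h∈ , s) = h , h∈ , sim-Ro s

  sim-Ro : ∀ {c G H} → Sim c G H → c ≤ Ro G → c ≤ Ro H
  sim-Ro (leaf a⇔b) = Equivalence.to a⇔b
  sim-Ro (node {⟨ _ ∣ gr ⟩} {⟨ _ ∣ hr ⟩} _ _ bf) =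
    minL-transfer gr hr (λ m → let (h , h∈ , _) = BackAndForth.forth bf right m in h , h∈)
                        (λ m → carryLo (BackAndForth.back bf right m))
    where
    carryLo : ∀ {c h gs} → ∃[ g ] g ∈ᴸ gs × Sim c g h → ∃[ g ] g ∈ᴸ gs × (c ≤ Lo g → c ≤ Lo h)
    carryLo (g , g∈ , s) = g , g∈ , sim-Lo s

sim-sym : ∀ {c G H} → Sim c G H → Sim c H G
sim-sym (leaf a⇔b) = leaf (⇔-sym a⇔b)
sim-sym {c} (node {G} {H} nG nH bf) = node nH nG (record { forth = forth′ ; back = back′ })
  where
  open BackAndForth bf
  forth′ : ∀ s {h} → h ∈ᴸ opts s H → ∃[ g ] g ∈ᴸ opts s G × Sim c h g
  forth′ s h∈ = let (g , g∈ , sim) = back s h∈ in g , g∈ , sim-sym sim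
  back′ : ∀ s {g} → g ∈ᴸ opts s G → ∃[ h ] h ∈ᴸ opts s H × Sim c h g
  back′ s g∈ = let (h , h∈ , sim) = forth s g∈ in h , h∈ , sim-sym sim

sim-parity : ∀ {c G H} → Sim c G H → Tempered G → Tempered H → parity G ≡ parity H
sim-parity (leaf _) _ _ = refl
sim-parity (node nG _ bf) tG tH with W-opt-exists left tG nG
... | g , g∈ with BackAndForth.forth bf left g∈
...   | h , h∈ , sim =
  let (tg , pg) = tempered-opt left tG g∈
      (th , ph) = tempered-opt left tH h∈
  in flipP-injective (trans (sym pg) (trans (sim-parity sim tg th) ph))

SimInvariant : (Game → ℤ) → Set
SimInvariant μ = ∀ {c G H} → parity G ≡ parity H → Sim c G H → c ≤ μ G → c ≤ μ H

Lo-invariant : SimInvariant Lo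
Lo-invariant _ = sim-Lo

Ro-invariant : SimInvariant Ro
Ro-invariant _ = sim-Ro

choose : Parity → ℤ → ℤ → ℤ
choose odd  x y = x
choose even x y = y

byParity : (Game → ℤ) → (Game → ℤ) → Game → ℤ
byParity μ ν G = choose (parity G) (μ G) (ν G)

byParity-invariant : ∀ {μ ν} → SimInvariant μ → SimInvariant ν → SimInvariant (byParity μ ν)
byParity-invariant {μ} {ν} μ-inv ν-inv {c} {G} {H} p≡ sim =
  choose-invariant (parity G) (parity H) p≡ (μ-inv p≡ sim) (ν-inv p≡ sim)
  where
  choose-invariant : ∀ p q → p ≡ q → (c ≤ μ G → c ≤ μ H) → (c ≤ ν G → c ≤ ν H) →
                     c ≤ choose p (μ G) (ν G) → c ≤ choose q (μ H) (ν H)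
  choose-invariant odd  _ refl μ-cut _ = μ-cut
  choose-invariant even _ refl _ ν-cut = ν-cut

invariant-≗ : ∀ {μ ν} → SimInvariant μ → (∀ G → ν G ≡ μ G) → SimInvariant ν
invariant-≗ {μ} μ-inv eq {c} {G} {H} p≡ sim c≤ =
  subst (c ≤_) (sym (eq H)) (μ-inv p≡ sim (subst (c ≤_) (eq G) c≤))

lf-invariant : SimInvariant lf
lf-invariant = invariant-≗ (byParity-invariant Lo-invariant Ro-invariant) lf-byParity
  where
  lf-byParity : ∀ G → lf G ≡ byParity Lo Ro G
  lf-byParity G with parity G
  ... | odd  = refl
  ... | even = refl

rf-invariant : SimInvariant rf
rf-invariant = invariant-≗ (byParity-invariant Ro-invariant Lo-invariant) rf-byParity
  where
  rf-byParity : ∀ G → rf G ≡ byParity Ro Lo G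
  rf-byParity G with parity G
  ... | odd  = refl
  ... | even = refl

order-preserving-cong : ∀ {k} {S : Fin k → Pred ℤ 0ℓ} {f} → OrderPreserving S f →
                        ∀ a b → (∀ l → a l ∈ S l) → (∀ l → a l ≡ b l) → f a ≡ f b
order-preserving-cong {S = S} f-mono a b a∈S a≡b =
  ℤP.≤-antisym (f-mono a b a∈S b∈S (λ l → ℤP.≤-reflexive (a≡b l)))
               (f-mono b a b∈S a∈S (λ l → ℤP.≤-reflexive (sym (a≡b l))))
  where
  b∈S : ∀ l → b l ∈ S l
  b∈S l = subst (_∈ S l) (a≡b l) (a∈S l)

num-injective : ∀ {a b} → num a ≡ num b → a ≡ b
num-injective refl = refl

AllLeaves-num : ∀ {Q G a} → G ≡ num a → AllLeaves Q G → Q a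
AllLeaves-num refl all = all (here refl)

update-cong : ∀ {k} (K M : Fin k → Game) j g l → (j ≢ l → K l ≡ M l) → update K j g l ≡ update M j g l
update-cong K M j g l eq with j ≟ᶠ l
... | yes _   = refl
... | no j≢l = eq j≢l

-- The auxiliary payoff φ(b) = c - t(b), where t(b) is
-- the threshold on V of "v reaches c in coordinate i", makes
--   f̃(K) + X   and   K i + φ̃(K[i ≔ X])
-- c-similar whenever the leaves of K i lie in V.  The right-hand side
-- depends on K i only through the first summand.
module OneCoordinate {k : ℕ} (S : Fin k → Pred ℤ 0ℓ) (f : (Fin k → ℤ) → ℤ) (f-mono : OrderPreserving S f)
                     (i : Fin k) (V : List ℤ) (V⊆S : ∀ {a} → a ∈ᴸ V → a ∈ S i) (c : ℤ) where

  Reaches : (Fin k → ℤ) → Pred ℤ 0ℓ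
  Reaches b v = c ≤ f (updateAt b i (const v)) ℤ.+ b i

  reaches? : ∀ b → Decidable (Reaches b)
  reaches? b v = c ℤ.≤? f (updateAt b i (const v)) ℤ.+ b i

  φ : (Fin k → ℤ) → ℤ
  φ b = c - threshold (reaches? b) V

  reaches-upClosed : ∀ b → (∀ l → l ≢ i → b l ∈ S l) → UpClosedOn (Reaches b) V
  reaches-upClosed b b∈S {v} {w} v∈ w∈ v≤w reach =
    ℤP.≤-trans reach (ℤP.+-monoˡ-≤ (b i) (f-mono _ _ (inS v∈) (inS w∈) raise))
    where
    inS : ∀ {x} → x ∈ᴸ V → ∀ l → updateAt b i (const x) l ∈ S l
    inS x∈ l with l ≟ᶠ i
    ... | yes refl = subst (_∈ S i) (sym (updateAt-updates i b)) (V⊆S x∈)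
    ... | no l≢i  = subst (_∈ S l) (sym (updateAt-minimal l i b l≢i)) (b∈S l l≢i)
    raise : ∀ l → updateAt b i (const v) l ≤ updateAt b i (const w) l
    raise l with l ≟ᶠ i
    ... | yes refl = subst₂ _≤_ (sym (updateAt-updates i b)) (sym (updateAt-updates i b)) v≤w
    ... | no l≢i  = ℤP.≤-reflexive (trans (updateAt-minimal l i b l≢i) (sym (updateAt-minimal l i b l≢i)))

  leaf-agree : ∀ a b → (∀ l → a l ∈ S l) → a i ∈ᴸ V → (∀ l → l ≢ i → a l ≡ b l) →
               c ≤ f a ℤ.+ b i ⇔ c ≤ a i ℤ.+ φ b
  leaf-agree a b a∈S a∈V a≡b =
    ⇔-sym (shift-cut c (a i) _) ⇔-∘ (threshold-spec _ V (reaches-upClosed b b∈S) a∈V ⇔-∘ same-f)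
    where
    b∈S : ∀ l → l ≢ i → b l ∈ S l
    b∈S l l≢i = subst (_∈ S l) (a≡b l l≢i) (a∈S l)
    a≡b[i≔ai] : ∀ l → a l ≡ updateAt b i (const (a i)) l
    a≡b[i≔ai] l with l ≟ᶠ i
    ... | yes refl = sym (updateAt-updates i b)
    ... | no l≢i  = trans (a≡b l l≢i) (sym (updateAt-minimal l i b l≢i))
    same-f : c ≤ f a ℤ.+ b i ⇔ Reaches b (a i)
    same-f rewrite order-preserving-cong {S = S} f-mono a _ a∈S a≡b[i≔ai] = mk⇔ id id

  open Extension using (∈-ext⁻; ∈-ext⁺; ext-node; ext-leaf)

  lhs : ℕ → (Fin k → Game) → (Fin k → Game) → Game
  lhs n K M = extFuel f n K + M i

  rhs : ℕ → (Fin k → Game) → (Fin k → Game) → Game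
  rhs n K M = K i + extFuel φ n M

  record Coupled (K M : Fin k → Game) : Set where
    field
      agree    : ∀ l → l ≢ i → K l ≡ M l
      leaves-S : ∀ l → l ≢ i → AllLeaves (_∈ S l) (K l)
      leaves-V : AllLeaves (_∈ᴸ V) (K i)
  open Coupled

  coupled-own : ∀ {K M} s {g} → Coupled K M → g ∈ᴸ opts s (K i) → Coupled (update K i g) M
  coupled-own {K} s {g} cpl g∈ = record
    { agree    = λ l l≢i → trans (update-other K i g l (≢-sym l≢i)) (agree cpl l l≢i)
    ; leaves-S = λ l l≢i → subst (AllLeaves (_∈ S l)) (sym (update-other K i g l (≢-sym l≢i))) (leaves-S cpl l l≢i)
    ; leaves-V = subst (AllLeaves (_∈ᴸ V)) (sym (update-same K i g)) (AllLeaves-opt s (K i) (leaves-V cpl) g∈)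
    }

  coupled-other : ∀ {K M} s j {g} → Coupled K M → j ≢ i → g ∈ᴸ opts s (K j) →
                  Coupled (update K j g) (update M j g)
  coupled-other {K} {M} s j {g} cpl j≢i g∈ = record
    { agree    = λ l l≢i → update-cong K M j g l (λ _ → agree cpl l l≢i)
    ; leaves-S = update-pointwise (λ l G → l ≢ i → AllLeaves (_∈ S l) G) K j g (leaves-S cpl)
                                  (λ _ → AllLeaves-opt s (K j) (leaves-S cpl j j≢i) g∈)
    ; leaves-V = subst (AllLeaves (_∈ᴸ V)) (sym (update-other K j g i j≢i)) (leaves-V cpl)
    }

  coupled-aux : ∀ {K M} m → Coupled K M → Coupled K (update M i m)
  coupled-aux {K} {M} m cpl = record
    { agree    = λ l l≢i → trans (agree cpl l l≢i) (sym (update-other M i m l (≢-sym l≢i)))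
    ; leaves-S = leaves-S cpl
    ; leaves-V = leaves-V cpl
    }

  nodes-from : ∀ n₁ n₂ {K M} → Coupled K M → ∀ j → IsNode (K j) →
               IsNode (lhs (suc n₁) K M) × IsNode (rhs (suc n₂) K M)
  nodes-from n₁ n₂ {K} {M} cpl j isNode with j ≟ᶠ i
  ... | yes refl = +-node _ _ (inj₁ (ext-node f n₁ K i isNode)) , +-node _ _ (inj₁ isNode)
  ... | no j≢i  = +-node _ _ (inj₁ (ext-node f n₁ K j isNode))
                , +-node _ _ (inj₂ (ext-node φ n₂ M j (subst IsNode (agree cpl j j≢i) isNode)))

  nodes-from-aux : ∀ n₁ n₂ {K M} → IsNode (M i) → IsNode (lhs (suc n₁) K M) × IsNode (rhs (suc n₂) K M)
  nodes-from-aux n₁ n₂ {K} {M} isNode = +-node _ _ (inj₂ isNode) , +-node _ _ (inj₂ (ext-node φ n₂ M i isNode))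

  simulate-leaf : ∀ n₁ n₂ {K M a b} → Coupled K M → allNum K ≡ just a → allNum M ≡ just b →
                  Sim c (lhs (suc n₁) K M) (rhs (suc n₂) K M)
  simulate-leaf n₁ n₂ {K} {M} {a} {b} cpl eqK eqM
    rewrite ext-leaf f n₁ K eqK | ext-leaf φ n₂ M eqM | allNum-just K eqK i | allNum-just M eqM i
    = leaf (leaf-agree a b a∈S (AllLeaves-num (allNum-just K eqK i) (leaves-V cpl)) a≡b)
    where
    a∈S : ∀ l → a l ∈ S l
    a∈S l with l ≟ᶠ i
    ... | yes refl = V⊆S (AllLeaves-num (allNum-just K eqK i) (leaves-V cpl))
    ... | no l≢i  = AllLeaves-num (allNum-just K eqK l) (leaves-S cpl l l≢i)
    a≡b : ∀ l → l ≢ i → a l ≡ b l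
    a≡b l l≢i = num-injective (trans (sym (allNum-just K eqK l)) (trans (agree cpl l l≢i) (allNum-just M eqM l)))

  mutual
    simulate : ∀ n₁ n₂ K M → Fuelled n₁ K → Fuelled n₂ M → Coupled K M → Sim c (lhs n₁ K M) (rhs n₂ K M)
    simulate (suc n₁) (suc n₂) K M fuel₁ fuel₂ cpl with shape M
    ... | someNode j isNode with j ≟ᶠ i
    ...   | yes refl = simulate-node n₁ n₂ K M fuel₁ fuel₂ cpl (nodes-from-aux n₁ n₂ isNode)
    ...   | no j≢i  = simulate-node n₁ n₂ K M fuel₁ fuel₂ cpl
                        (nodes-from n₁ n₂ cpl j (subst IsNode (sym (agree cpl j j≢i)) isNode))
    simulate (suc n₁) (suc n₂) K M fuel₁ fuel₂ cpl | allNumbers b eqM with shape K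
    ... | someNode j isNode = simulate-node n₁ n₂ K M fuel₁ fuel₂ cpl (nodes-from n₁ n₂ cpl j isNode)
    ... | allNumbers a eqK  = simulate-leaf n₁ n₂ cpl eqK eqM

    -- Each move on one side is answered by the same move on the other side.
    simulate-node : ∀ n₁ n₂ K M → Fuelled (suc n₁) K → Fuelled (suc n₂) M → Coupled K M →
                    IsNode (lhs (suc n₁) K M) × IsNode (rhs (suc n₂) K M) →
                    Sim c (lhs (suc n₁) K M) (rhs (suc n₂) K M)
    simulate-node n₁ n₂ K M fuel₁ fuel₂ cpl (nodeL , nodeR) = node nodeL nodeR (record { forth = forth ; back = back })
      where
      own-move : ∀ s {g} → g ∈ᴸ opts s (K i) → Sim c (extFuel f n₁ (update K i g) + M i) (g + extFuel φ (suc n₂) M)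
      own-move s {g} g∈ = subst (λ x → Sim c (extFuel f n₁ (update K i g) + M i) (x + extFuel φ (suc n₂) M)) (update-same K i g)
        (simulate n₁ (suc n₂) (update K i g) M (fuelled-move n₁ K s i fuel₁ g∈) fuel₂ (coupled-own s cpl g∈))

      other-move : ∀ s j {g} → j ≢ i → g ∈ᴸ opts s (K j) →
                   Sim c (extFuel f n₁ (update K j g) + M i) (K i + extFuel φ n₂ (update M j g))
      other-move s j {g} j≢i g∈ =
        subst₂ (λ x y → Sim c (extFuel f n₁ (update K j g) + x) (y + extFuel φ n₂ (update M j g))) (update-other M j g i j≢i) (update-other K j g i j≢i)
          (simulate n₁ n₂ (update K j g) (update M j g) (fuelled-move n₁ K s j fuel₁ g∈)
            (fuelled-move n₂ M s j fuel₂ (subst (λ G → _ ∈ᴸ opts s G) (agree cpl j j≢i) g∈))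
            (coupled-other s j cpl j≢i g∈))

      aux-move : ∀ s {m} → m ∈ᴸ opts s (M i) → Sim c (extFuel f (suc n₁) K + m) (K i + extFuel φ n₂ (update M i m))
      aux-move s {m} m∈ = subst (λ x → Sim c (extFuel f (suc n₁) K + x) (K i + extFuel φ n₂ (update M i m))) (update-same M i m)
        (simulate (suc n₁) n₂ K (update M i m) fuel₁ (fuelled-move n₂ M s i fuel₂ m∈) (coupled-aux m cpl))

      forth : ∀ s {x} → x ∈ᴸ opts s (lhs (suc n₁) K M) → ∃[ y ] y ∈ᴸ opts s (rhs (suc n₂) K M) × Sim c x y
      forth s x∈ with ∈-+⁻ s _ (M i) x∈
      ... | inj₂ (m , m∈ , refl) = _ , ∈-+⁺ʳ s (K i) _ (∈-ext⁺ φ s n₂ M i m∈) , aux-move s m∈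
      ... | inj₁ (e , e∈ , refl) with ∈-ext⁻ f s n₁ K e∈
      ...   | j , g , g∈ , refl with j ≟ᶠ i
      ...     | yes refl = _ , ∈-+⁺ˡ s (K i) _ g∈ , own-move s g∈
      ...     | no j≢i  = _ , ∈-+⁺ʳ s (K i) _ (∈-ext⁺ φ s n₂ M j (subst (λ G → _ ∈ᴸ opts s G) (agree cpl j j≢i) g∈))
                            , other-move s j j≢i g∈

      back : ∀ s {y} → y ∈ᴸ opts s (rhs (suc n₂) K M) → ∃[ x ] x ∈ᴸ opts s (lhs (suc n₁) K M) × Sim c x y
      back s y∈ with ∈-+⁻ s (K i) _ y∈
      ... | inj₁ (g , g∈ , refl) = _ , ∈-+⁺ˡ s _ (M i) (∈-ext⁺ f s n₁ K i g∈) , own-move s g∈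
      ... | inj₂ (z , z∈ , refl) with ∈-ext⁻ φ s n₂ M z∈
      ...   | j , m , m∈ , refl with j ≟ᶠ i
      ...     | yes refl = _ , ∈-+⁺ʳ s _ (M i) m∈ , aux-move s m∈
      ...     | no j≢i  = _ , ∈-+⁺ˡ s _ (M i) (∈-ext⁺ f s n₁ K j m∈′) , other-move s j j≢i m∈′
        where
        m∈′ : m ∈ᴸ opts s (K j)
        m∈′ = subst (λ G → _ ∈ᴸ opts s G) (sym (agree cpl j j≢i)) m∈

  similar : ∀ K M → Coupled K M → Sim c (ext f K + M i) (K i + ext φ M)
  similar K M = simulate _ _ K M ℕP.≤-refl ℕP.≤-refl

-- The three basic relations; the other six are their converses and conjunctions.
data Basic : Set where
  ≲ᵇ ≲₊ᵇ ≲₋ᵇ : Basic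

⟪_⟫ : Basic → Game → Game → Set
⟪ ≲ᵇ  ⟫ G H = G ≲ H
⟪ ≲₊ᵇ ⟫ G H = G ≲₊ H
⟪ ≲₋ᵇ ⟫ G H = G ≲₋ H

basic-refl : ∀ r G → ⟪ r ⟫ G G
basic-refl ≲ᵇ  G = λ _ _ → ℤP.≤-refl , ℤP.≤-refl
basic-refl ≲₊ᵇ G = refl , λ _ _ → ℤP.≤-refl
basic-refl ≲₋ᵇ G = refl , λ _ _ → ℤP.≤-refl

basic-trans : ∀ r {A B C} → ⟪ r ⟫ A B → ⟪ r ⟫ B C → ⟪ r ⟫ A C
basic-trans ≲ᵇ  AB BC X X∈ = ℤP.≤-trans (proj₁ (AB X X∈)) (proj₁ (BC X X∈)) , ℤP.≤-trans (proj₂ (AB X X∈)) (proj₂ (BC X X∈))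
basic-trans ≲₊ᵇ (p , AB) (q , BC) = trans p q , λ X X∈ → ℤP.≤-trans (AB X X∈) (BC X X∈)
basic-trans ≲₋ᵇ (p , AB) (q , BC) = trans p q , λ X X∈ → ℤP.≤-trans (AB X X∈) (BC X X∈)

module OneStep {k : ℕ} (S : Fin k → Pred ℤ 0ℓ) (f : (Fin k → ℤ) → ℤ) (f-mono : OrderPreserving S f)
               (K K′ : Fin k → Game) (i : Fin k) (agree : ∀ l → l ≢ i → K l ≡ K′ l)
               (K∈ : ∀ j → InW (S j) (K j)) (K′∈ : ∀ j → InW (S j) (K′ j)) where

  open Extension using (ext-InW; ext-parity)

  V : List ℤ
  V = leaves (K i) ++ leaves (K′ i)

  V⊆S : ∀ {a} → a ∈ᴸ V → a ∈ S i
  V⊆S a∈ with ∈-++⁻ (leaves (K i)) a∈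
  ... | inj₁ a∈K  = W-leaves (proj₂ (K∈ i)) a∈K
  ... | inj₂ a∈K′ = W-leaves (proj₂ (K′∈ i)) a∈K′

  module _ (c : ℤ) (X : Game) where
    open OneCoordinate S f f-mono i V V⊆S c

    coupled : ∀ T → (∀ j → InW (S j) (T j)) → (∀ l → l ≢ i → T l ≡ K l) → AllLeaves (_∈ᴸ V) (T i) →
              Coupled T (update K i X)
    coupled T T∈ T≡K T-V = record
      { agree    = λ l l≢i → trans (T≡K l l≢i) (sym (update-other K i X l (≢-sym l≢i)))
      ; leaves-S = λ l _ → W-leaves (proj₂ (T∈ l))
      ; leaves-V = T-V
      }

    similar-to : ∀ T → (∀ j → InW (S j) (T j)) → (∀ l → l ≢ i → T l ≡ K l) → AllLeaves (_∈ᴸ V) (T i) →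
                 Sim c (ext f T + X) (T i + ext φ (update K i X))
    similar-to T T∈ T≡K T-V = subst (λ x → Sim c (ext f T + x) (T i + ext φ (update K i X))) (update-same K i X)
      (similar T (update K i X) (coupled T T∈ T≡K T-V))

    opponent-InW : InW U X → InW U (ext φ (update K i X))
    opponent-InW X∈ = ext-InW φ (update K i X)
      (update-pointwise (λ _ G → Tempered G) K i X (λ j → tempered (K∈ j)) (tempered X∈))

  transfer : ∀ {μ} → SimInvariant μ → (∀ Z → InW U Z → μ (K i + Z) ≤ μ (K′ i + Z)) →
             ∀ X → InW U X → μ (ext f K + X) ≤ μ (ext f K′ + X)
  transfer {μ} μ-inv hyp X X∈ =
    μ-inv (sym (sim-parity sim′ t-extK′ t-K′Z)) (sim-sym sim′)
          (ℤP.≤-trans (μ-inv (sim-parity sim t-extK t-KZ) sim ℤP.≤-refl) (hyp Z Z∈))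
    where
    c : ℤ
    c = μ (ext f K + X)
    open OneCoordinate S f f-mono i V V⊆S c using (φ)
    Z : Game
    Z = ext φ (update K i X)
    Z∈ : InW U Z
    Z∈ = opponent-InW c X X∈
    sim : Sim c (ext f K + X) (K i + Z)
    sim = similar-to c X K K∈ (λ _ _ → refl) ∈-++⁺ˡ
    sim′ : Sim c (ext f K′ + X) (K′ i + Z)
    sim′ = similar-to c X K′ K′∈ (λ l l≢i → sym (agree l l≢i)) (∈-++⁺ʳ (leaves (K i)))
    t-extK : Tempered (ext f K + X)
    t-extK = tempered (InW-+ (ext-InW f K (λ j → tempered (K∈ j))) X∈)
    t-extK′ : Tempered (ext f K′ + X)
    t-extK′ = tempered (InW-+ (ext-InW f K′ (λ j → tempered (K′∈ j))) X∈)
    t-KZ : Tempered (K i + Z)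
    t-KZ = tempered (InW-+ (_ , W-U (proj₂ (K∈ i))) Z∈)
    t-K′Z : Tempered (K′ i + Z)
    t-K′Z = tempered (InW-+ (_ , W-U (proj₂ (K′∈ i))) Z∈)

  parity-step : parity (K i) ≡ parity (K′ i) → parity (ext f K) ≡ parity (ext f K′)
  parity-step par =
    trans (ext-parity f K (λ j → tempered (K∈ j)))
          (trans (parityΣ-cong _ _ same) (sym (ext-parity f K′ (λ j → tempered (K′∈ j)))))
    where
    same : ∀ j → parity (K j) ≡ parity (K′ j)
    same j with j ≟ᶠ i
    ... | yes refl = par
    ... | no j≢i  = cong parity (agree j j≢i)

  step : ∀ r → ⟪ r ⟫ (K i) (K′ i) → ⟪ r ⟫ (ext f K) (ext f K′)
  step ≲ᵇ  hyp X X∈ = transfer Lo-invariant (λ Z Z∈ → proj₁ (hyp Z Z∈)) X X∈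
                    , transfer Ro-invariant (λ Z Z∈ → proj₂ (hyp Z Z∈)) X X∈
  step ≲₊ᵇ (par , hyp) = parity-step par , transfer lf-invariant hyp
  step ≲₋ᵇ (par , hyp) = parity-step par , transfer rf-invariant hyp

step-≗ : ∀ {k} (S : Fin k → Pred ℤ 0ℓ) f → OrderPreserving S f → ∀ r (K K′ : Fin k → Game) →
         (∀ j → K j ≡ K′ j) → (∀ j → InW (S j) (K j)) → (∀ j → InW (S j) (K′ j)) →
         ⟪ r ⟫ (ext f K) (ext f K′)
step-≗ {zero}  S f f-mono r K K′ K≗K′ K∈ K′∈ = basic-refl r _
step-≗ {suc k} S f f-mono r K K′ K≗K′ K∈ K′∈ =
  OneStep.step S f f-mono K K′ zero (λ l _ → K≗K′ l) K∈ K′∈ r (subst (⟪ r ⟫ (K zero)) (K≗K′ zero) (basic-refl r _))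

module Hybrid {k : ℕ} (S : Fin k → Pred ℤ 0ℓ) (f : (Fin k → ℤ) → ℤ) (f-mono : OrderPreserving S f)
              (r : Basic) (G H : Fin k → Game)
              (G∈ : ∀ j → InW (S j) (G j)) (H∈ : ∀ j → InW (S j) (H j)) where

  hybrid : ℕ → Fin k → Game
  hybrid m j with toℕ j ℕ.<? m
  ... | yes _ = H j
  ... | no  _ = G j

  hybrid∈ : ∀ m j → InW (S j) (hybrid m j)
  hybrid∈ m j with toℕ j ℕ.<? m
  ... | yes _ = H∈ j
  ... | no  _ = G∈ j

  hybrid-H : ∀ m j → toℕ j ℕ.< m → hybrid m j ≡ H j
  hybrid-H m j j<m with toℕ j ℕ.<? m
  ... | yes _  = refl
  ... | no j≮m = contradiction j<m j≮m

  hybrid-G : ∀ m j → ¬ toℕ j ℕ.< m → hybrid m j ≡ G j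
  hybrid-G m j j≮m with toℕ j ℕ.<? m
  ... | yes j<m = contradiction j<m j≮m
  ... | no  _   = refl

  hybrid-suc : ∀ m l → toℕ l ≢ m → hybrid m l ≡ hybrid (suc m) l
  hybrid-suc m l l≢m with toℕ l ℕ.<? m | toℕ l ℕ.<? suc m
  ... | yes _   | yes _   = refl
  ... | no  _   | no  _   = refl
  ... | yes l<m | no  l≮m = contradiction (ℕP.m<n⇒m<1+n l<m) l≮m
  ... | no  l≮m | yes l<m = contradiction (ℕP.≤∧≢⇒< (ℕP.≤-pred l<m) l≢m) l≮m

  hybrids : (∀ j → ⟪ r ⟫ (G j) (H j)) → ∀ m → m ℕ.≤ k → ⟪ r ⟫ (ext f G) (ext f (hybrid m))
  hybrids G≤H zero _ = step-≗ S f f-mono r G (hybrid 0) (λ j → sym (hybrid-G 0 j (λ ()))) G∈ (hybrid∈ 0)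
  hybrids G≤H (suc m) m<k =
    basic-trans r (hybrids G≤H m (ℕP.<⇒≤ m<k))
      (OneStep.step S f f-mono (hybrid m) (hybrid (suc m)) i
        (λ l l≢i → hybrid-suc m l (λ l≡m → l≢i (FinP.toℕ-injective (trans l≡m (sym i≡m)))))
        (hybrid∈ m) (hybrid∈ (suc m)) r
        (subst₂ ⟪ r ⟫ (sym (hybrid-G m i (λ i<m → ℕP.<-irrefl i≡m i<m)))
                      (sym (hybrid-H (suc m) i (ℕP.≤-reflexive (cong suc i≡m)))) (G≤H i)))
    where
    i : Fin k
    i = fromℕ< m<k
    i≡m : toℕ i ≡ m
    i≡m = FinP.toℕ-fromℕ< m<k

  ext-monotone : (∀ j → ⟪ r ⟫ (G j) (H j)) → ⟪ r ⟫ (ext f G) (ext f H)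
  ext-monotone G≤H =
    basic-trans r (hybrids G≤H k ℕP.≤-refl)
      (step-≗ S f f-mono r (hybrid k) H (λ j → hybrid-H k j (FinP.toℕ<n j)) (hybrid∈ k) H∈)

-- Each of the nine relations is a basic relation, its converse, or both.
mainTheorem13 : (k : ℕ) (S : Fin k → Pred ℤ 0ℓ) (T : Pred ℤ 0ℓ)
    (f : (Fin k → ℤ) → ℤ)
    → (∀ a → (∀ i → a i ∈ S i) → f a ∈ T)
    → OrderPreserving S f
    → (□ : Rel) (G H : Fin k → Game)
    → (∀ i → InW (S i) (G i)) → (∀ i → InW (S i) (H i))
    → (∀ i → ⟦ □ ⟧ (G i) (H i))
    → ⟦ □ ⟧ (ext f G) (ext f H)
mainTheorem13 k S T f _ f-mono □ G H G∈ H∈ G□H = by-relation □ G□H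
  where
  forward : ∀ r → (∀ j → ⟪ r ⟫ (G j) (H j)) → ⟪ r ⟫ (ext f G) (ext f H)
  forward r = Hybrid.ext-monotone S f f-mono r G H G∈ H∈
  backward : ∀ r → (∀ j → ⟪ r ⟫ (H j) (G j)) → ⟪ r ⟫ (ext f H) (ext f G)
  backward r = Hybrid.ext-monotone S f f-mono r H G H∈ G∈
  by-relation : ∀ □ → (∀ i → ⟦ □ ⟧ (G i) (H i)) → ⟦ □ ⟧ (ext f G) (ext f H)
  by-relation `≲  h = forward ≲ᵇ h
  by-relation `≳  h = backward ≲ᵇ h
  by-relation `≲₊ h = forward ≲₊ᵇ h
  by-relation `≲₋ h = forward ≲₋ᵇ h
  by-relation `≳₊ h = backward ≲₊ᵇ h
  by-relation `≳₋ h = backward ≲₋ᵇ h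
  by-relation `≈  h = forward ≲ᵇ (proj₁ ∘ h) , backward ≲ᵇ (proj₂ ∘ h)
  by-relation `≈₊ h = forward ≲₊ᵇ (proj₁ ∘ h) , backward ≲₊ᵇ (proj₂ ∘ h)
  by-relation `≈₋ h = forward ≲₋ᵇ (proj₁ ∘ h) , backward ≲₋ᵇ (proj₂ ∘ h)
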